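{- Let $M$ be a reachable marking of a t-net $N$. Then there is exactly one pid-tree in $\mathit{repr}(M)$ that is stripped (with respect to $M$).
   Context: Process identifiers (pids). $\mathbb{P}=(\mathbb{N}^+)^*$ is the set of finite tuples of positive integers, including $\langle\rangle$, under concatenation; $\langle a_1,\dots,a_n\rangle$ is written $a_1.\cdots.a_n$. For $\pi=\langle a_1,\dots,a_n\rangle$: $\mathit{prefix}(\pi)=\langle a_1,\dots,a_{n-1}\rangle$ if $n>0$, else $\langle\rangle$; $\mathit{subpid}(\pi)=\{\pi\}\cup\mathit{subpid}(\mathit{prefix}(\pi))$ if $n>0$, $\emptyset$ if $n=0$. $\mathbb P$ is ordered hierarchically: by length, then lexicographically. Coloured Petri nets and t-nets. Fix data values $\mathbb D\supseteq\mathbb N$ (disjoint from $\mathbb P$), variables $\mathbb V$, expressions $\mathbb E\supseteq\mathbb V\cup\mathbb D$; bindings are partial maps $\beta:\mathbb V\to\mathbb P\cup\mathbb D$ extended to expressions. A Petri net $(S,T,\ell)$ has finite disjoint places and transitions, place types $\ell(s)=X_1\times\dots\times X_k$ ($X_i\in\{\mathbb P,\mathbb D\}$), guards $\ell(t)\in\mathbb E$, arc labels $\ell(x,y)$ multisets over $\mathbb E$. A marking maps places to multisets of tokens of their type; $M\xrightarrow{t,\beta}M'$ iff $M(s)\ge\beta(\ell(s,t))$, $\beta(\ell(t,s))$ has type $\ell(s)$, $M'(s)=M(s)-\beta(\ell(s,t))+\beta(\ell(t,s))$ for all $s$, and $\beta(\ell(t))$ holds. A t-net additionally has: a unique generator place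 $s_\eta$ of type $\mathbb P\times\mathbb N$; initial marking with $M_0(s_\eta)=\{\langle\langle1\rangle,0\rangle\}$, other places empty or containing only data; for each $t$, $\ell(s_\eta,t)=\{\langle p_i,c_i\rangle:1\le i\le k\}$ (distinct variables) and $\ell(t,s_\eta)=\{\langle p_i,c_i+n_i\rangle:1\le i\le m\}\cup\{\langle p_i.(c_i+j),0\rangle:1\le i\le k,1\le j\le n_i\}$ ($m\le k$, $n_i\ge0$), $\Pi_t$ being the set of the $p_i.(c_i+j)$; arcs from $s\ne s_\eta$ carry vectors of variables and data values; arcs to $s\ne s_\eta$ carry vectors of expressions over data variables/values and elements of $\Pi_t\cup\{p_1,\dots,p_m\}$; guards are computable Boolean expressions in which pids are only compared by equality, parent, ancestor and younger-sibling relations. Reachable markings are reached from $M_0$ by finitely many firings. States. For reachable $M$: $\eta_M=\{\pi\mapsto k:\langle\pi,k\rangle\in M(s_\eta)\}$; $\mathit{nextpid}_M=\{\pi.(\eta_M(\pi)+1):\pi\in\mathrm{dom}(\eta_M)\}$; $\mathit{pid}_M$ is the set of pids occurring in tokens of $M$ in any place (including $s_\eta$); these are the active pids of $M$. Pid-trees. $\Xi$ is the least set with $\langle M,C\rangle\in\Xi$ for a marking $M$ and $C=\langle\langle a_1,t_1\rangle,\dots,\langle a_n,t_n\rangle\rangle$, $t_i\in\Xi$, $a_i\in\mathbb P\setminus\{\langle\rangle\}$, for $i\ne j$: $a_i\ne a_j$, $a_i\notin\mathit{subpid}(a_j)$, $a_j\notin\mathit{subpid}(a_i)$; written $M\xrightarrow{a_1,\dots,a_n}\langle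 t_1,\dots,t_n\rangle$. Inclusion: $\langle M',\langle\langle a'_i,t'_i\rangle\rangle_{i\le m}\rangle\subseteq\langle M,\langle\langle a_j,t_j\rangle\rangle_{j\le n}\rangle$ iff $M'\le M$ and each $i$ has $j$ with $a'_i=a_j$, $t'_i\subseteq t_j$. Subtrees: $\langle\langle\rangle,t_0\rangle\in\mathit{Trees}(t_0)$ and $\langle a_i.\pi',t\rangle\in\mathit{Trees}(t_0)$ if $\langle\pi',t\rangle\in\mathit{Trees}(t_i)$; $\mathit{pid}(t)=\{\pi:\langle\pi,t'\rangle\in\mathit{Trees}(t)\}$. Path labelled $\pi$ decorated by $M'$: pid-tree $t$ with $\pi\in\mathit{pid}(t)\subseteq\mathit{subpid}(\pi)\cup\{\langle\rangle\}$, $\langle\pi,\langle M',\langle\rangle\rangle\rangle\in\mathit{Trees}(t)$, all other markings empty; "$R$ contains $\mathit{path}(\pi,M')$" means such a path is $\subseteq R$; $\mathit{path}(\pi)=\mathit{path}(\pi,\emptyset)$. Sibling ordered: $a_1\le\dots\le a_n$ (hierarchically) at every node. A pid-tree $T$ is stripped (with respect to $M$) if every nonempty $\pi\in\mathit{pid}(T)$ belongs to $\mathit{pid}_M\cup\mathit{nextpid}_M$, i.e. $T$ has no node labelled by an inactive pid other than next-pids. Representations. $\mathit{repr}(M)$: sibling ordered pid-trees $R$ built so that for each place $s$ of type $X_1\times\dots\times X_n$ and token $v=\langle x_1,\dots,x_n\rangle\in M(s)$ exactly one rule applies, and $R$ contains nothing beyond what the rules require (tokens with multiplicity): generator rule ($s=s_\eta$,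 $v=\langle\pi,i\rangle$): $R$ contains $\mathit{path}(\pi)$ and $\mathit{path}(\pi.(i+1))$; shared rule ($X_1=\mathbb D$): $R$ contains $\mathit{path}(\langle\rangle,\{(s,v)\})$ and $\mathit{path}(x_i)$ for every $X_i=\mathbb P$; owned rule ($X_1=\mathbb P$): $R$ contains $\mathit{path}(x_1,\{(s,v)\})$ and $\mathit{path}(x_i)$ for every $X_i=\mathbb P$. -}

module Defs where

open import Data.Nat using (ℕ; zero; suc; _+_; _∸_; _≤_; _<_; _<ᵇ_)
open import Data.Bool using (Bool; true; false; if_then_else_)
open import Data.Fin using (Fin; toℕ)
open import Data.Fin.Properties using () renaming (_≟_ to _≟F_)
open import Data.List using (List; []; _∷_; _++_; length; map; [_])
open import Data.List.Properties using () renaming (≡-dec to List-≡-dec)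
open import Data.List.Relation.Unary.All using (All)
open import Data.List.Relation.Unary.Any using (Any)
open import Data.List.Relation.Unary.AllPairs using (AllPairs)
open import Data.List.Relation.Unary.Linked using (Linked)
open import Data.List.Relation.Binary.Pointwise using (Pointwise)
open import Data.List.Membership.Propositional using (_∈_)
open import Data.Vec using (Vec; []; _∷_)
open import Data.Maybe using (Maybe; just; nothing)
open import Data.Product using (Σ; ∃; _×_; _,_; proj₁; proj₂)
open import Data.Product.Properties using () renaming (≡-dec to ×-≡-dec)
open import Data.Sum using (_⊎_; inj₁; inj₂)
open import Data.Unit using (⊤; tt)
open import Data.Empty using (⊥)
open import Relation.Nullary using (¬_; Dec; yes; no; does)
open import Relation.Binary.PropositionalEquality using (_≡_; _≢_; refl; cong)
open import Relation.Binary.Definitions using (DecidableEquality)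
import Data.Nat.Properties as ℕP

-- Positive integers and process identifiers

-- A positive integer, represented by its predecessor: (pos n) stands for n+1.
record ℕ⁺ : Set where
  constructor pos
  field pred : ℕ
open ℕ⁺ public

value⁺ : ℕ⁺ → ℕ
value⁺ (pos n) = suc n

-- the positive integer n (meaningful for n ≥ 1)
_⁺ : ℕ → ℕ⁺
n ⁺ = pos (n ∸ 1)

_≟⁺_ : DecidableEquality ℕ⁺
pos m ≟⁺ pos n with m ℕP.≟ n
... | yes refl = yes refl
... | no m≢n = no (λ e → m≢n (cong pred e))

-- ℙ = (ℕ⁺)*, a₁.⋯.aₙ written as a list; ⟨⟩ is []
Pid : Set
Pid = List ℕ⁺

_≟P_ : DecidableEquality Pid
_≟P_ = List-≡-dec _≟⁺_

prefix : Pid → Pid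
prefix [] = []
prefix (a ∷ []) = []
prefix (a ∷ b ∷ π) = a ∷ prefix (b ∷ π)

-- ρ ∈sub π  means  ρ ∈ subpid(π)
-- subpid(π) = {π} ∪ subpid(prefix π) if π ≠ ⟨⟩, ∅ otherwise
data _∈sub_ : Pid → Pid → Set where
  here  : ∀ {π} → π ≢ [] → π ∈sub π
  there : ∀ {ρ π} → π ≢ [] → ρ ∈sub prefix π → ρ ∈sub π

data _≤lex_ : Pid → Pid → Set where
  []≤  : ∀ {π} → [] ≤lex π
  <∷   : ∀ {a b π ρ} → value⁺ a < value⁺ b → (a ∷ π) ≤lex (b ∷ ρ)
  ≡∷   : ∀ {a π ρ} → π ≤lex ρ → (a ∷ π) ≤lex (a ∷ ρ)

_≤H_ : Pid → Pid → Set
π ≤H ρ = (length π < length ρ) ⊎ (length π ≡ length ρ × π ≤lex ρ)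

-- pid relations available in guards
IsParent : Pid → Pid → Set
IsParent a b = ∃ λ x → b ≡ a ++ [ x ]

IsAncestor : Pid → Pid → Set
IsAncestor a b = ∃ λ σ → σ ≢ [] × b ≡ a ++ σ

IsYoungerSibling : Pid → Pid → Set
IsYoungerSibling a b =
  ∃ λ ρ → ∃ λ x → ∃ λ y → a ≡ ρ ++ [ x ] × b ≡ ρ ++ [ y ] × value⁺ y < value⁺ x

𝟙[_] : ∀ {p} {P : Set p} → Dec P → ℕ
𝟙[ d ] = if does d then 1 else 0

sumFin : (k : ℕ) → (Fin k → ℕ) → ℕ
sumFin zero f = 0
sumFin (suc k) f = f Fin.zero + sumFin k (λ i → f (Fin.suc i))
  where import Data.Fin as Fin

sum1to : ℕ → (ℕ → ℕ) → ℕ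
sum1to zero f = 0
sum1to (suc n) f = sum1to n f + f (suc n)

-- multiplicity of an element in a list (lists model finite multisets)
count : ∀ {A : Set} → DecidableEquality A → List A → A → ℕ
count _≟_ [] x = 0
count _≟_ (y ∷ ys) x = 𝟙[ y ≟ x ] + count _≟_ ys x

mapMaybe! : ∀ {A B : Set} → (A → Maybe B) → List A → Maybe (List B)
mapMaybe! f [] = just []
mapMaybe! f (x ∷ xs) with f x | mapMaybe! f xs
... | just y | just ys = just (y ∷ ys)
... | _ | _ = nothing

-- The fixed universe: data values 𝔻 ⊇ ℕ (disjoint from ℙ) and variables 𝕍

record Setting : Set₁ where
  field
    D        : Set
    _≟D_     : DecidableEquality D
    natD     : ℕ → D                      -- the inclusion ℕ ⊆ 𝔻
    natD-inj : ∀ {m n} → natD m ≡ natD n → m ≡ n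
    V        : Set

data Sort : Set where
  𝐏 𝐃 : Sort

-- a place type X₁ × ⋯ × Xₖ (k ≥ 1): first sort and the remaining ones
PlaceType : Set
PlaceType = Sort × List Sort

arity : PlaceType → ℕ
arity (x , xs) = suc (length xs)

module _ (S : Setting) where
  open Setting S

  Value : Set
  Value = Pid ⊎ D

  Binding : Set
  Binding = V → Maybe Value

  ⟦_⟧ₛ : Sort → Set
  ⟦ 𝐏 ⟧ₛ = Pid
  ⟦ 𝐃 ⟧ₛ = D

  TokL : List Sort → Set
  TokL [] = ⊤
  TokL (x ∷ xs) = ⟦ x ⟧ₛ × TokL xs

  Tok : PlaceType → Set
  Tok (x , xs) = ⟦ x ⟧ₛ × TokL xs

  decS : (x : Sort) → DecidableEquality ⟦ x ⟧ₛ
  decS 𝐏 = _≟P_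
  decS 𝐃 = _≟D_

  decTL : (xs : List Sort) → DecidableEquality (TokL xs)
  decTL [] tt tt = yes refl
  decTL (x ∷ xs) = ×-≡-dec (decS x) (λ {_} → decTL xs)

  decT : (ty : PlaceType) → DecidableEquality (Tok ty)
  decT (x , xs) = ×-≡-dec (decS x) (λ {_} → decTL xs)

  pidC : (x : Sort) → ⟦ x ⟧ₛ → List Pid
  pidC 𝐏 π = [ π ]
  pidC 𝐃 d = []

  pidsL : (xs : List Sort) → TokL xs → List Pid
  pidsL [] tt = []
  pidsL (x ∷ xs) (v , vs) = pidC x v ++ pidsL xs vs

  pidsOf : (ty : PlaceType) → Tok ty → List Pid
  pidsOf (x , xs) (v , vs) = pidC x v ++ pidsL xs vs

  -- Expressions

  data DExpr : Set where
    dvar : V → DExpr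
    dval : D → DExpr
    dapp : (n : ℕ) → (Vec D n → D) → Vec DExpr n → DExpr

  mutual
    evalD : Binding → DExpr → Maybe D
    evalD β (dvar x) with β x
    ... | just (inj₂ d) = just d
    ... | _ = nothing
    evalD β (dval d) = just d
    evalD β (dapp n f es) with evalDs β es
    ... | just ds = just (f ds)
    ... | nothing = nothing

    evalDs : ∀ {n} → Binding → Vec DExpr n → Maybe (Vec D n)
    evalDs β [] = just []
    evalDs β (e ∷ es) with evalD β e | evalDs β es
    ... | just d | just ds = just (d ∷ ds)
    ... | _ | _ = nothing

  -- guards: computable Boolean expressions; pids are compared only by
  -- equality, parent, ancestor and younger-sibling relations
  data Guard : Set where
    gtrue   : Guard
    gnot    : Guard → Guard
    gand    : Guard → Guard → Guard
    gdata   : (n : ℕ) → (Vec D n → Bool) → Vec DExpr n → Guard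
    gpidEq gparent gancestor gyounger : V → V → Guard

  BoundPid : Binding → V → Pid → Set
  BoundPid β x π = β x ≡ just (inj₁ π)

  pidRel : (Pid → Pid → Set) → Binding → V → V → Set
  pidRel R β x y = ∃ λ a → ∃ λ b → BoundPid β x a × BoundPid β y b × R a b

  Holds : Binding → Guard → Set
  Holds β gtrue = ⊤
  Holds β (gnot g) = ¬ Holds β g
  Holds β (gand g h) = Holds β g × Holds β h
  Holds β (gdata n f es) = ∃ λ ds → evalDs β es ≡ just ds × f ds ≡ true
  Holds β (gpidEq x y) = pidRel _≡_ β x y
  Holds β (gparent x y) = pidRel IsParent β x y
  Holds β (gancestor x y) = pidRel IsAncestor β x y
  Holds β (gyounger x y) = pidRel IsYoungerSibling β x y

  -- input arcs from s ≠ s_η: vectors of variables and data values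
  Pat : Set
  Pat = V ⊎ D

  evalPatC : Binding → (x : Sort) → Pat → Maybe ⟦ x ⟧ₛ
  evalPatC β 𝐏 (inj₁ v) with β v
  ... | just (inj₁ π) = just π
  ... | _ = nothing
  evalPatC β 𝐏 (inj₂ d) = nothing
  evalPatC β 𝐃 (inj₁ v) with β v
  ... | just (inj₂ d) = just d
  ... | _ = nothing
  evalPatC β 𝐃 (inj₂ d) = just d

  evalPatL : Binding → (xs : List Sort) → Vec Pat (length xs) → Maybe (TokL xs)
  evalPatL β [] [] = just tt
  evalPatL β (x ∷ xs) (p ∷ ps) with evalPatC β x p | evalPatL β xs ps
  ... | just v | just vs = just (v , vs)
  ... | _ | _ = nothing

  evalPat : Binding → (ty : PlaceType) → Vec Pat (arity ty) → Maybe (Tok ty)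
  evalPat β (x , xs) (p ∷ ps) with evalPatC β x p | evalPatL β xs ps
  ... | just v | just vs = just (v , vs)
  ... | _ | _ = nothing

  -- output arcs to s ≠ s_η: pid components are elements of
  -- {p₁,…,pₘ} (kept i) or of Π_t (new i j = p_i.(c_i + j), 1 ≤ j ≤ n_i);
  -- data components are data expressions
  data OutPid (k : ℕ) : Set where
    kept : Fin k → OutPid k
    new  : Fin k → ℕ → OutPid k

  OutC : ℕ → Sort → Set
  OutC k 𝐏 = OutPid k
  OutC k 𝐃 = DExpr

  OutL : ℕ → List Sort → Set
  OutL k [] = ⊤
  OutL k (x ∷ xs) = OutC k x × OutL k xs

  OutVec : ℕ → PlaceType → Set
  OutVec k (x , xs) = OutC k x × OutL k xs

  OutPidOK : ∀ {k} → (m : ℕ) → (Fin k → ℕ) → OutPid k → Set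
  OutPidOK m n (kept i) = toℕ i < m
  OutPidOK m n (new i j) = 1 ≤ j × j ≤ n i

  OutCOK : ∀ {k} → (m : ℕ) → (Fin k → ℕ) → (x : Sort) → OutC k x → Set
  OutCOK m n 𝐏 o = OutPidOK m n o
  OutCOK m n 𝐃 e = ⊤

  OutLOK : ∀ {k} → (m : ℕ) → (Fin k → ℕ) → (xs : List Sort) → OutL k xs → Set
  OutLOK m n [] tt = ⊤
  OutLOK m n (x ∷ xs) (o , os) = OutCOK m n x o × OutLOK m n xs os

  OutVecOK : ∀ {k} → (m : ℕ) → (Fin k → ℕ) → (ty : PlaceType) → OutVec k ty → Set
  OutVecOK m n (x , xs) (o , os) = OutCOK m n x o × OutLOK m n xs os

  -- evaluation of output expressions, given the values π_i, c_i bound to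
  -- the generator variables p_i, c_i
  module _ {k : ℕ} (β : Binding) (π : Fin k → Pid) (c : Fin k → ℕ) where
    evalOutC : (x : Sort) → OutC k x → Maybe ⟦ x ⟧ₛ
    evalOutC 𝐏 (kept i) = just (π i)
    evalOutC 𝐏 (new i j) = just (π i ++ [ (c i + j) ⁺ ])
    evalOutC 𝐃 e = evalD β e

    evalOutL : (xs : List Sort) → OutL k xs → Maybe (TokL xs)
    evalOutL [] tt = just tt
    evalOutL (x ∷ xs) (o , os) with evalOutC x o | evalOutL xs os
    ... | just v | just vs = just (v , vs)
    ... | _ | _ = nothing

    evalOut : (ty : PlaceType) → OutVec k ty → Maybe (Tok ty)
    evalOut (x , xs) (o , os) with evalOutC x o | evalOutL xs os
    ... | just v | just vs = just (v , vs)
    ... | _ | _ = nothing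

  -- Markings.  Places other than the generator are Fin nS; the generator
  -- place s_η (of type ℙ × ℕ) is represented by the separate field gen.
  -- Multisets are multiplicity functions.

  record Marking (nS : ℕ) (ℓ : Fin nS → PlaceType) : Set where
    constructor mk
    field
      gen : Pid × ℕ → ℕ
      tok : (s : Fin nS) → Tok (ℓ s) → ℕ
  open Marking public

  module _ {nS : ℕ} {ℓ : Fin nS → PlaceType} where
    _≤M_ : Marking nS ℓ → Marking nS ℓ → Set
    M ≤M M' = (∀ x → gen M x ≤ gen M' x) × (∀ s v → tok M s v ≤ tok M' s v)

    _≈M_ : Marking nS ℓ → Marking nS ℓ → Set
    M ≈M M' = (∀ x → gen M x ≡ gen M' x) × (∀ s v → tok M s v ≡ tok M' s v)

    ∅M : Marking nS ℓ
    ∅M = mk (λ _ → 0) (λ _ _ → 0)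

    IsEmptyM : Marking nS ℓ → Set
    IsEmptyM M = M ≈M ∅M

    singleCount : (s : Fin nS) → Tok (ℓ s) → ℕ → (s' : Fin nS) → Tok (ℓ s') → ℕ
    singleCount s v k s' v' with s ≟F s'
    ... | yes refl = if does (decT (ℓ s) v v') then k else 0
    ... | no _ = 0

    single : (s : Fin nS) → Tok (ℓ s) → ℕ → Marking nS ℓ
    single s v k = mk (λ _ → 0) (singleCount s v k)

  record Transition (nS : ℕ) (ℓ : Fin nS → PlaceType) : Set where
    field
      -- ℓ(s_η,t) = {⟨p_i,c_i⟩ : 1 ≤ i ≤ k}, distinct variables
      k    : ℕ
      pv   : Fin k → V
      cv   : Fin k → V
      pv-inj  : ∀ i j → pv i ≡ pv j → i ≡ j
      cv-inj  : ∀ i j → cv i ≡ cv j → i ≡ j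
      pv≢cv   : ∀ i j → pv i ≢ cv j
      -- ℓ(t,s_η) = {⟨p_i,c_i+n_i⟩ : i ≤ m} ∪ {⟨p_i.(c_i+j),0⟩ : i ≤ k, 1 ≤ j ≤ n_i}
      m    : ℕ
      m≤k  : m ≤ k
      n    : Fin k → ℕ
      inArc    : (s : Fin nS) → List (Vec Pat (arity (ℓ s)))
      outArc   : (s : Fin nS) → List (OutVec k (ℓ s))
      outArcOK : (s : Fin nS) → All (OutVecOK m n (ℓ s)) (outArc s)
      guard : Guard

  record TNet : Set where
    field
      nS : ℕ                         -- places other than s_η
      nT : ℕ
      ℓ  : Fin nS → PlaceType
      trans : Fin nT → Transition nS ℓ
      init : (s : Fin nS) → Tok (ℓ s) → ℕ
      init-data : ∀ s v → 0 < init s v → pidsOf (ℓ s) v ≡ []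
      init-fin  : ∃ λ (l : List (Σ (Fin nS) (λ s → Tok (ℓ s)))) →
                    ∀ s v → 0 < init s v → (s , v) ∈ l

  module _ (N : TNet) where
    open TNet N

    Mark : Set
    Mark = Marking nS ℓ

    _≟G_ : DecidableEquality (Pid × ℕ)
    _≟G_ = ×-≡-dec _≟P_ ℕP._≟_

    M₀ : Mark
    M₀ = mk (λ x → 𝟙[ x ≟G ([ pos 0 ] , 0) ]) init

    Fires : Mark → Fin nT → Binding → Mark → Set
    Fires M t β M' =
      Σ (Fin k → Pid) λ π → Σ (Fin k → ℕ) λ c →
        (∀ i → β (pv i) ≡ just (inj₁ (π i))) ×
        (∀ i → β (cv i) ≡ just (inj₂ (natD (c i)))) ×
        (∀ x → inG π c x ≤ gen M x) ×
        (∀ x → gen M' x ≡ gen M x ∸ inG π c x + outG π c x) ×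
        Σ ((s : Fin nS) → List (Tok (ℓ s))) λ ins →
        Σ ((s : Fin nS) → List (Tok (ℓ s))) λ outs →
          (∀ s → mapMaybe! (evalPat β (ℓ s)) (inArc s) ≡ just (ins s)) ×
          (∀ s → mapMaybe! (evalOut β π c (ℓ s)) (outArc s) ≡ just (outs s)) ×
          (∀ s v → count (decT (ℓ s)) (ins s) v ≤ tok M s v) ×
          (∀ s v → tok M' s v ≡ tok M s v ∸ count (decT (ℓ s)) (ins s) v
                                           + count (decT (ℓ s)) (outs s) v) ×
          Holds β guard
      where
        open Transition (trans t)
        inG : (Fin k → Pid) → (Fin k → ℕ) → Pid × ℕ → ℕ
        inG π c x = sumFin k (λ i → 𝟙[ (π i , c i) ≟G x ])
        outG : (Fin k → Pid) → (Fin k → ℕ) → Pid × ℕ → ℕ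
        outG π c x = sumFin k (λ i →
          (if toℕ i <ᵇ m then 𝟙[ (π i , c i + n i) ≟G x ] else 0)
          + sum1to (n i) (λ j → 𝟙[ (π i ++ [ (c i + j) ⁺ ] , 0) ≟G x ]))

    data Reachable : Mark → Set where
      base : Reachable M₀
      step : ∀ {M M'} t β → Reachable M → Fires M t β M' → Reachable M'

    η : Mark → Pid → ℕ → Set
    η M π i = 0 < gen M (π , i)

    ActivePid : Mark → Pid → Set
    ActivePid M π =
      (∃ λ i → 0 < gen M (π , i)) ⊎
      (∃ λ s → ∃ λ v → 0 < tok M s v × π ∈ pidsOf (ℓ s) v)

    NextPid : Mark → Pid → Set
    NextPid M π = ∃ λ ρ → ∃ λ i → η M ρ i × π ≡ ρ ++ [ pos i ]

    data PTree : Set where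
      node : Mark → List (Pid × PTree) → PTree

    Independent : Pid → Pid → Set
    Independent a b = a ≢ b × ¬ (a ∈sub b) × ¬ (b ∈sub a)

    data IsPidTree : PTree → Set where
      node : ∀ {M cs} →
             All (λ c → proj₁ c ≢ []) cs →
             AllPairs Independent (map proj₁ cs) →
             All (λ c → IsPidTree (proj₂ c)) cs →
             IsPidTree (node M cs)

    data Sub : Pid → PTree → PTree → Set where
      here  : ∀ {t} → Sub [] t t
      there : ∀ {M cs a ti π t'} → (a , ti) ∈ cs → Sub π ti t' →
              Sub (a ++ π) (node M cs) t'

    _∈pid_ : Pid → PTree → Set
    π ∈pid t = ∃ λ t' → Sub π t t'

    data _⊆T_ : PTree → PTree → Set where
      node : ∀ {M' cs' M cs} → M' ≤M M →
             All (λ c' → Any (λ c → proj₁ c' ≡ proj₁ c × proj₂ c' ⊆T proj₂ c) cs) cs' →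
             node M' cs' ⊆T node M cs

    -- equality of pid-trees (markings compared extensionally)
    data _≋_ : PTree → PTree → Set where
      node : ∀ {M cs M' cs'} → M ≈M M' →
             Pointwise (λ c c' → proj₁ c ≡ proj₁ c' × proj₂ c ≋ proj₂ c') cs cs' →
             node M cs ≋ node M' cs'

    IsPath : Pid → Mark → PTree → Set
    IsPath π M' t =
      IsPidTree t ×
      Sub π t (node M' []) ×
      (∀ ρ → ρ ∈pid t → ρ ∈sub π ⊎ ρ ≡ []) ×
      (∀ ρ M'' cs → Sub ρ t (node M'' cs) → ρ ≢ π → IsEmptyM M'')

    ContainsPath : PTree → Pid → Mark → Set
    ContainsPath R π M' = ∃ λ t → IsPath π M' t × t ⊆T R

    data SiblingOrdered : PTree → Set where
      node : ∀ {M cs} → Linked _≤H_ (map proj₁ cs) →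
             All (λ c → SiblingOrdered (proj₂ c)) cs →
             SiblingOrdered (node M cs)

    Stripped : Mark → PTree → Set
    Stripped M T = ∀ π → π ∈pid T → π ≢ [] → ActivePid M π ⊎ NextPid M π

    -- Representations

    -- the pid decorated by a token of a place s ≠ s_η: ⟨⟩ for the shared
    -- rule (X₁ = 𝔻), x₁ for the owned rule (X₁ = ℙ)
    decoratedPid : (ty : PlaceType) → Tok ty → Pid
    decoratedPid (𝐏 , xs) (x₁ , _) = x₁
    decoratedPid (𝐃 , xs) _ = []

    RulesHold : Mark → PTree → Set
    RulesHold M R =
      (∀ π i → 0 < gen M (π , i) →
         ContainsPath R π ∅M × ContainsPath R (π ++ [ pos i ]) ∅M) ×
      (∀ s v → 0 < tok M s v →
         ContainsPath R (decoratedPid (ℓ s) v) (single s v (tok M s v)) ×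
         All (λ π → ContainsPath R π ∅M) (pidsOf (ℓ s) v))

    Repr : Mark → PTree → Set
    Repr M R =
      IsPidTree R × SiblingOrdered R × RulesHold M R ×
      (∀ R' → IsPidTree R' → R' ⊆T R → RulesHold M R' → R ⊆T R')

module Submission where

-- Idea.  A representation of M need contain no pid beyond those the rules ask
-- for: the active pids and next pids of M (plus the root ⟨⟩), each node π
-- decorated by the tokens whose decorated pid is π.  We construct this
-- canonical tree R explicitly and show that it is a stripped representation,
-- and that any stripped representation R′ has the same pids as R, hence
-- R ⊆ R′ (pids and markings are forced by the rules), R′ ⊆ R (minimality of
-- R′), and finally R′ ≋ R because inclusion is antisymmetric on sibling
-- ordered pid-trees.

open import Defs
open import Data.Nat using (ℕ; zero; suc; _+_; _∸_; _≤_; _<_; _<ᵇ_; _⊔_; z≤n; s≤s)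
import Data.Nat.Properties as ℕₚ
open import Data.Bool using (true; if_then_else_)
open import Data.Fin using (Fin; toℕ)
import Data.Fin as Fin
import Data.Fin.Properties as Finₚ
open import Function using (_∘_)
open import Data.List
  using (List; []; _∷_; _++_; length; [_]; map; filter; drop; concat; concatMap; tabulate; upTo;
         deduplicate; foldr)
open import Data.List.Properties
  using (++-identityʳ; ++-assoc; ++-cancelˡ; ∷-injective; length-++; map-∘)
open import Data.List.Relation.Unary.All as All using (All; []; _∷_)
import Data.List.Relation.Unary.All.Properties as Allₚ
open import Data.List.Relation.Unary.Any using (Any; here; there; any?)
open import Data.List.Relation.Unary.AllPairs as AllPairs using (AllPairs; []; _∷_)
import Data.List.Relation.Unary.AllPairs.Properties as AllPairsₚ
open import Data.List.Relation.Unary.Linked using (Linked; []; [-]; _∷_)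
import Data.List.Relation.Unary.Linked.Properties as Linkedₚ
import Data.List.Relation.Unary.Unique.DecPropositional.Properties as Unique
open import Data.List.Relation.Binary.Pointwise using (Pointwise; []; _∷_)
open import Data.List.Membership.Propositional using (_∈_; find; lose)
open import Data.List.Membership.Propositional.Properties
  using (∈-++⁺ˡ; ∈-++⁺ʳ; ∈-++⁻; ∈-map⁺; ∈-map⁻; ∈-filter⁺; ∈-filter⁻; ∈-deduplicate⁺;
         ∈-deduplicate⁻; ∈-concat⁺′; ∈-concatMap⁺; ∈-concatMap⁻; ∈-tabulate⁺; ∈-upTo⁺)
open import Data.List.Relation.Binary.Permutation.Propositional using (↭-sym; ↭⇒↭ₛ)
open import Data.List.Relation.Binary.Permutation.Propositional.Properties using (∈-resp-↭)
import Data.List.Relation.Binary.Permutation.Setoid.Properties as Permutationₛ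
import Data.List.Sort as ListSort
open import Data.Product using (Σ; ∃; _×_; _,_; proj₁; proj₂; uncurry)
open import Data.Sum using (_⊎_; inj₁; inj₂)
open import Data.Empty using (⊥-elim)
open import Relation.Nullary using (¬_; Dec; yes; no; does)
open import Relation.Nullary.Decidable using (_×-dec_; ¬?)
open import Relation.Binary.PropositionalEquality
  using (_≡_; _≢_; refl; sym; trans; cong; subst; subst₂; setoid; isEquivalence; module ≡-Reasoning)
open import Relation.Binary.Bundles using (DecTotalOrder)
open import Relation.Binary.Definitions using (DecidableEquality; tri<; tri≈; tri>)
open import Relation.Binary.Consequences using (total∧dec⇒dec)

-- Prefixes of pids

_⊑_ : Pid → Pid → Set
σ ⊑ π = ∃ λ r → π ≡ σ ++ r

_⊏_ : Pid → Pid → Set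
σ ⊏ π = ∃ λ r → r ≢ [] × π ≡ σ ++ r

module _ {A : Set} where

  ++-nonemptyʳ : ∀ (a : List A) {r} → r ≢ [] → a ++ r ≢ []
  ++-nonemptyʳ [] r≢[] = r≢[]
  ++-nonemptyʳ (x ∷ a) r≢[] ()

  ++-emptyˡ : ∀ (a : List A) {r} → a ++ r ≡ [] → a ≡ []
  ++-emptyˡ [] _ = refl
  ++-emptyˡ (x ∷ a) ()

  ++-emptyʳ : ∀ (a : List A) {r} → a ++ r ≡ [] → r ≡ []
  ++-emptyʳ [] e = e
  ++-emptyʳ (x ∷ a) ()

  ++-comparable : ∀ (a b : List A) {x y} → a ++ x ≡ b ++ y →
                  (∃ λ r → b ≡ a ++ r) ⊎ (∃ λ r → a ≡ b ++ r)
  ++-comparable [] b e = inj₁ (b , refl)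
  ++-comparable (u ∷ a) [] e = inj₂ (u ∷ a , refl)
  ++-comparable (u ∷ a) (v ∷ b) e with ∷-injective e
  ... | refl , e′ with ++-comparable a b e′
  ...   | inj₁ (r , refl) = inj₁ (r , refl)
  ...   | inj₂ (r , refl) = inj₂ (r , refl)

prefix-snoc : ∀ (a : Pid) x → prefix (a ++ [ x ]) ≡ a
prefix-snoc [] x = refl
prefix-snoc (y ∷ []) x = refl
prefix-snoc (y ∷ z ∷ a) x = cong (y ∷_) (prefix-snoc (z ∷ a) x)

snoc-prefix : ∀ (π : Pid) → π ≢ [] → ∃ λ l → π ≡ prefix π ++ [ l ]
snoc-prefix [] π≢[] = ⊥-elim (π≢[] refl)
snoc-prefix (a ∷ []) _ = a , refl
snoc-prefix (a ∷ b ∷ π) _ with snoc-prefix (b ∷ π) (λ ())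
... | l , e = l , cong (a ∷_) e

-- subpid(π) consists exactly of the nonempty prefixes of π

∈sub-trans : ∀ {σ ρ π} → σ ∈sub ρ → ρ ∈sub π → σ ∈sub π
∈sub-trans σ∈ρ (here _) = σ∈ρ
∈sub-trans σ∈ρ (there π≢[] ρ∈π) = there π≢[] (∈sub-trans σ∈ρ ρ∈π)

∈sub-++ : ∀ {a} → a ≢ [] → ∀ r → a ∈sub (a ++ r)
∈sub-++ {a} a≢[] [] = subst (a ∈sub_) (sym (++-identityʳ a)) (here a≢[])
∈sub-++ {a} a≢[] (x ∷ r) =
  subst (a ∈sub_) (++-assoc a [ x ] r) (∈sub-trans a∈ax (∈sub-++ ax≢[] r))
  where
  ax≢[] : a ++ [ x ] ≢ []
  ax≢[] = ++-nonemptyʳ a (λ ())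
  a∈ax : a ∈sub (a ++ [ x ])
  a∈ax = there ax≢[] (subst (a ∈sub_) (sym (prefix-snoc a x)) (here a≢[]))

∈sub⇒⊑ : ∀ {ρ π} → ρ ∈sub π → ρ ⊑ π
∈sub⇒⊑ {ρ} (here _) = [] , sym (++-identityʳ ρ)
∈sub⇒⊑ {ρ} {π} (there π≢[] ρ∈pre) with ∈sub⇒⊑ ρ∈pre | snoc-prefix π π≢[]
... | x , pre≡ρx | l , π≡prel =
  x ++ [ l ] , trans π≡prel (trans (cong (_++ [ l ]) pre≡ρx) (++-assoc ρ x [ l ]))

∈sub⇒nonempty : ∀ {ρ π} → ρ ∈sub π → ρ ≢ []
∈sub⇒nonempty (here ρ≢[]) = ρ≢[]
∈sub⇒nonempty (there _ ρ∈pre) = ∈sub⇒nonempty ρ∈pre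

++-comparable-∈sub : ∀ (a b : Pid) {x y} → a ≢ [] → b ≢ [] → a ++ x ≡ b ++ y →
                     a ∈sub b ⊎ b ∈sub a
++-comparable-∈sub a b a≢[] b≢[] e with ++-comparable a b e
... | inj₁ (r , refl) = inj₁ (∈sub-++ a≢[] r)
... | inj₂ (r , refl) = inj₂ (∈sub-++ b≢[] r)

∈sub-++ˡ : ∀ a {ρ π} → ρ ∈sub π → (a ++ ρ) ∈sub (a ++ π)
∈sub-++ˡ a {ρ} ρ∈π with ∈sub⇒⊑ ρ∈π
... | x , refl = subst ((a ++ ρ) ∈sub_) (++-assoc a ρ x)
                   (∈sub-++ (++-nonemptyʳ a (∈sub⇒nonempty ρ∈π)) x)

_⊑?_ : (σ π : Pid) → Dec (σ ⊑ π)
[] ⊑? π = yes (π , refl)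
(a ∷ σ) ⊑? [] = no λ ()
(a ∷ σ) ⊑? (b ∷ π) with a ≟⁺ b | σ ⊑? π
... | yes refl | yes (r , e) = yes (r , cong (a ∷_) e)
... | yes refl | no σ⋢π = no λ { (r , e) → σ⋢π (r , proj₂ (∷-injective e)) }
... | no a≢b | _ = no λ { (r , e) → a≢b (sym (proj₁ (∷-injective e))) }

_⊏?_ : (σ π : Pid) → Dec (σ ⊏ π)
σ ⊏? π with σ ⊑? π
... | no σ⋢π = no λ { (r , _ , e) → σ⋢π (r , e) }
... | yes (r , e) with r ≟P []
...   | no r≢[] = yes (r , r≢[] , e)
...   | yes refl = no λ { (r′ , r′≢[] , e′) →
                   r′≢[] (sym (++-cancelˡ σ [] r′ (trans (sym e) e′))) }

⊏-trans : ∀ {σ ρ π} → σ ⊏ ρ → ρ ⊏ π → σ ⊏ π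
⊏-trans {σ} (r , _ , refl) (r′ , r′≢[] , refl) =
  r ++ r′ , ++-nonemptyʳ r r′≢[] , ++-assoc σ r r′

-- a proper prefix is shorter; this bounds the depth of the trees built below
⊏-length : ∀ {σ π} → σ ⊏ π → length σ < length π
⊏-length {σ} (x ∷ r , _ , refl) =
  subst (length σ <_) (sym (length-++ σ)) (ℕₚ.m<m+n (length σ) (s≤s z≤n))
⊏-length ([] , []≢[] , _) = ⊥-elim ([]≢[] refl)

suffix : Pid → Pid → Pid
suffix σ π = drop (length σ) π

suffix-++ : ∀ (σ r : Pid) → suffix σ (σ ++ r) ≡ r
suffix-++ [] r = refl
suffix-++ (x ∷ σ) r = suffix-++ σ r

⊏-split : ∀ {σ π} → σ ⊏ π → π ≡ σ ++ suffix σ π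
⊏-split {σ} (r , _ , refl) = cong (σ ++_) (sym (suffix-++ σ r))

suffix-nonempty : ∀ {σ π} → σ ⊏ π → suffix σ π ≢ []
suffix-nonempty {σ} (r , r≢[] , refl) e = r≢[] (trans (sym (suffix-++ σ r)) e)

⊑⇒≡⊎⊏ : ∀ {σ π} → σ ⊑ π → σ ≡ π ⊎ σ ⊏ π
⊑⇒≡⊎⊏ {σ} ([] , e) = inj₁ (sym (trans e (++-identityʳ σ)))
⊑⇒≡⊎⊏ (x ∷ r , e) = inj₂ (x ∷ r , (λ ()) , e)

suffix-⊑ : ∀ {σ u v} → σ ⊏ u → σ ⊏ v → suffix σ u ⊑ suffix σ v → u ⊑ v
suffix-⊑ {σ} {u} {v} σ⊏u σ⊏v (z , e) = z , (begin
  v                        ≡⟨ ⊏-split σ⊏v ⟩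
  σ ++ suffix σ v          ≡⟨ cong (σ ++_) e ⟩
  σ ++ (suffix σ u ++ z)   ≡⟨ ++-assoc σ _ z ⟨
  (σ ++ suffix σ u) ++ z   ≡⟨ cong (_++ z) (⊏-split σ⊏u) ⟨
  u ++ z                   ∎)
  where open ≡-Reasoning

-- The hierarchical order is a decidable total order (so pids can be sorted)

≤lex-refl : ∀ π → π ≤lex π
≤lex-refl [] = []≤
≤lex-refl (a ∷ π) = ≡∷ (≤lex-refl π)

≤lex-trans : ∀ {π ρ τ} → π ≤lex ρ → ρ ≤lex τ → π ≤lex τ
≤lex-trans []≤ _ = []≤
≤lex-trans (<∷ p) (<∷ q) = <∷ (ℕₚ.<-trans p q)
≤lex-trans (<∷ p) (≡∷ _) = <∷ p
≤lex-trans (≡∷ _) (<∷ q) = <∷ q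
≤lex-trans (≡∷ p) (≡∷ q) = ≡∷ (≤lex-trans p q)

≤lex-antisym : ∀ {π ρ} → π ≤lex ρ → ρ ≤lex π → π ≡ ρ
≤lex-antisym []≤ []≤ = refl
≤lex-antisym (<∷ p) (<∷ q) = ⊥-elim (ℕₚ.<-asym p q)
≤lex-antisym (<∷ p) (≡∷ _) = ⊥-elim (ℕₚ.<-irrefl refl p)
≤lex-antisym (≡∷ _) (<∷ q) = ⊥-elim (ℕₚ.<-irrefl refl q)
≤lex-antisym {a ∷ _} (≡∷ p) (≡∷ q) = cong (a ∷_) (≤lex-antisym p q)

≤lex-total : ∀ π ρ → π ≤lex ρ ⊎ ρ ≤lex π
≤lex-total [] ρ = inj₁ []≤
≤lex-total (a ∷ π) [] = inj₂ []≤
≤lex-total (pos a ∷ π) (pos b ∷ ρ) with ℕₚ.<-cmp (suc a) (suc b)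
... | tri< a<b _ _ = inj₁ (<∷ a<b)
... | tri> _ _ b<a = inj₂ (<∷ b<a)
... | tri≈ _ refl _ with ≤lex-total π ρ
...   | inj₁ π≤ρ = inj₁ (≡∷ π≤ρ)
...   | inj₂ ρ≤π = inj₂ (≡∷ ρ≤π)

≤H-trans : ∀ {π ρ τ} → π ≤H ρ → ρ ≤H τ → π ≤H τ
≤H-trans (inj₁ p) (inj₁ q) = inj₁ (ℕₚ.<-trans p q)
≤H-trans (inj₁ p) (inj₂ (e , _)) = inj₁ (subst (_ <_) e p)
≤H-trans (inj₂ (e , _)) (inj₁ q) = inj₁ (subst (_< _) (sym e) q)
≤H-trans (inj₂ (e , p)) (inj₂ (e′ , q)) = inj₂ (trans e e′ , ≤lex-trans p q)

≤H-antisym : ∀ {π ρ} → π ≤H ρ → ρ ≤H π → π ≡ ρ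
≤H-antisym (inj₁ p) (inj₁ q) = ⊥-elim (ℕₚ.<-asym p q)
≤H-antisym (inj₁ p) (inj₂ (e , _)) = ⊥-elim (ℕₚ.<-irrefl (sym e) p)
≤H-antisym (inj₂ (e , _)) (inj₁ q) = ⊥-elim (ℕₚ.<-irrefl (sym e) q)
≤H-antisym (inj₂ (_ , p)) (inj₂ (_ , q)) = ≤lex-antisym p q

≤H-total : ∀ π ρ → π ≤H ρ ⊎ ρ ≤H π
≤H-total π ρ with ℕₚ.<-cmp (length π) (length ρ)
... | tri< p _ _ = inj₁ (inj₁ p)
... | tri> _ _ p = inj₂ (inj₁ p)
... | tri≈ _ e _ with ≤lex-total π ρ
...   | inj₁ q = inj₁ (inj₂ (e , q))
...   | inj₂ q = inj₂ (inj₂ (sym e , q))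

≤H-reflexive : ∀ {π ρ} → π ≡ ρ → π ≤H ρ
≤H-reflexive {π} refl = inj₂ (refl , ≤lex-refl π)

≤H-decTotalOrder : DecTotalOrder _ _ _
≤H-decTotalOrder = record
  { Carrier = Pid ; _≈_ = _≡_ ; _≤_ = _≤H_
  ; isDecTotalOrder = record
    { isTotalOrder = record
      { isPartialOrder = record
        { isPreorder = record
          { isEquivalence = isEquivalence ; reflexive = ≤H-reflexive ; trans = ≤H-trans }
        ; antisym = ≤H-antisym }
      ; total = ≤H-total }
    ; _≟_ = _≟P_
    ; _≤?_ = total∧dec⇒dec ≤H-reflexive ≤H-antisym ≤H-total _≟P_ } }

≤lex-cancelˡ : ∀ (σ : Pid) {a b} → (σ ++ a) ≤lex (σ ++ b) → a ≤lex b
≤lex-cancelˡ [] p = p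
≤lex-cancelˡ (x ∷ σ) (<∷ p) = ⊥-elim (ℕₚ.<-irrefl refl p)
≤lex-cancelˡ (x ∷ σ) (≡∷ p) = ≤lex-cancelˡ σ p

≤H-cancelˡ : ∀ (σ : Pid) {a b} → (σ ++ a) ≤H (σ ++ b) → a ≤H b
≤H-cancelˡ σ {a} {b} (inj₁ p)
  rewrite length-++ σ {a} | length-++ σ {b} = inj₁ (ℕₚ.+-cancelˡ-< (length σ) _ _ p)
≤H-cancelˡ σ {a} {b} (inj₂ (e , p))
  rewrite length-++ σ {a} | length-++ σ {b} =
  inj₂ (ℕₚ.+-cancelˡ-≡ (length σ) _ _ e , ≤lex-cancelˡ σ p)

suffix-≤H : ∀ {σ x y} → σ ⊏ x → σ ⊏ y → x ≤H y → suffix σ x ≤H suffix σ y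
suffix-≤H {σ} σ⊏x σ⊏y x≤y = ≤H-cancelˡ σ (subst₂ _≤H_ (⊏-split σ⊏x) (⊏-split σ⊏y) x≤y)

_<H_ : Pid → Pid → Set
π <H ρ = π ≤H ρ × π ≢ ρ

open ListSort ≤H-decTotalOrder using (sort; sort-↭; sort-↗)

normalise : List Pid → List Pid
normalise L = sort (deduplicate _≟P_ L)

normalise⁺ : ∀ {π L} → π ∈ L → π ∈ normalise L
normalise⁺ π∈L = ∈-resp-↭ (↭-sym (sort-↭ _)) (∈-deduplicate⁺ _≟P_ π∈L)

normalise⁻ : ∀ {π} L → π ∈ normalise L → π ∈ L
normalise⁻ L π∈ = ∈-deduplicate⁻ _≟P_ L (∈-resp-↭ (sort-↭ _) π∈)

normalise-unique : ∀ L → AllPairs _≢_ (normalise L)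
normalise-unique L = Permutationₛ.Unique-resp-↭ (setoid Pid) (↭⇒↭ₛ (↭-sym (sort-↭ _)))
                       (Unique.deduplicate-! _≟P_ L)

normalise-sorted : ∀ L → Linked _≤H_ (normalise L)
normalise-sorted L = sort-↗ _

maxLength : List Pid → ℕ
maxLength = foldr (λ π m → length π ⊔ m) 0

maxLength-≥ : ∀ {π πs} → π ∈ πs → length π ≤ maxLength πs
maxLength-≥ {π} {_ ∷ πs} (here refl) = ℕₚ.m≤m⊔n (length π) (maxLength πs)
maxLength-≥ {π} {ρ ∷ πs} (there π∈) =
  ℕₚ.≤-trans (maxLength-≥ π∈) (ℕₚ.m≤n⊔m (length ρ) (maxLength πs))

module _ {A : Set} {Q : A → Set} {R R′ : A → A → Set}
         (restrict : ∀ {x y} → Q x → Q y → R x y → R′ x y) where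

  AllPairs-restrict : ∀ {xs} → All Q xs → AllPairs R xs → AllPairs R′ xs
  AllPairs-restrict [] [] = []
  AllPairs-restrict (qx ∷ qxs) (Rx ∷ Rxs) =
    All.zipWith (λ (qy , r) → restrict qx qy r) (qxs , Rx) ∷ AllPairs-restrict qxs Rxs

  Linked-restrict : ∀ {xs} → All Q xs → Linked R xs → Linked R′ xs
  Linked-restrict _ [] = []
  Linked-restrict _ [-] = [-]
  Linked-restrict (qx ∷ qy ∷ qxs) (r ∷ rs) = restrict qx qy r ∷ Linked-restrict (qy ∷ qxs) rs

Covers : {A : Set} → (A → ℕ) → List A → Set
Covers f L = ∀ x → 0 < f x → x ∈ L

𝟙-positive : ∀ {p} {P : Set p} (d : Dec P) → 0 < 𝟙[ d ] → P
𝟙-positive (yes p) _ = p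

+-positive : ∀ m {n} → 0 < m + n → 0 < m ⊎ 0 < n
+-positive zero n>0 = inj₂ n>0
+-positive (suc m) _ = inj₁ (s≤s z≤n)

∸+-positive : ∀ m k {n} → 0 < m ∸ k + n → 0 < m ⊎ 0 < n
∸+-positive zero k p rewrite ℕₚ.0∸n≡0 k = inj₂ p
∸+-positive (suc m) k _ = inj₁ (s≤s z≤n)

if-positive : ∀ b {n} → 0 < (if b then n else 0) → 0 < n
if-positive true p = p

if-≤ : ∀ {p} {A : Set p} (d : Dec A) {n m} → (A → n ≤ m) → (if does d then n else 0) ≤ m
if-≤ (yes a) n≤m = n≤m a
if-≤ (no _) _ = z≤n

if-self : ∀ {p} {A : Set p} (d : Dec A) {n} → A → (if does d then n else 0) ≡ n
if-self (yes _) _ = refl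
if-self (no ¬a) a = ⊥-elim (¬a a)

≤-when-positive : ∀ {n m} → (0 < n → n ≤ m) → n ≤ m
≤-when-positive {zero} _ = z≤n
≤-when-positive {suc n} n≤m = n≤m (s≤s z≤n)

sumFin-positive : ∀ k (f : Fin k → ℕ) → 0 < sumFin k f → ∃ λ i → 0 < f i
sumFin-positive (suc k) f p with +-positive (f Fin.zero) p
... | inj₁ q = Fin.zero , q
... | inj₂ q with sumFin-positive k (λ i → f (Fin.suc i)) q
...   | i , r = Fin.suc i , r

sum1to-positive : ∀ n (f : ℕ → ℕ) → 0 < sum1to n f → ∃ λ j → j < n × 0 < f (suc j)
sum1to-positive (suc n) f p with +-positive (sum1to n f) p
... | inj₂ q = n , ℕₚ.n<1+n n , q
... | inj₁ q with sum1to-positive n f q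
...   | j , j<n , r = j , ℕₚ.m<n⇒m<1+n j<n , r

count-covers : ∀ {A : Set} (_≟_ : DecidableEquality A) xs → Covers (count _≟_ xs) xs
count-covers _≟_ (y ∷ ys) x p with +-positive 𝟙[ y ≟ x ] p
... | inj₁ q = here (sym (𝟙-positive (y ≟ x) q))
... | inj₂ q = there (count-covers _≟_ ys x q)

-- Reachable markings are finitely supported

module Support (S : Setting) (N : TNet S) where
  open TNet N using (nS; ℓ; init-fin) renaming (trans to transition)

  Token : Set
  Token = Σ (Fin nS) (λ s → Tok S (ℓ s))

  FinitelySupported : Mark S N → Set
  FinitelySupported M =
    (∃ λ (Lg : List (Pid × ℕ)) → Covers (gen M) Lg) ×
    (∃ λ (Lt : List Token) → Covers (uncurry (tok M)) Lt)

  M₀-finitelySupported : FinitelySupported (M₀ S N)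
  M₀-finitelySupported =
    ([ [ pos 0 ] , 0 ] , λ x p → here (𝟙-positive (_≟G_ S N x _) p)) ,
    (proj₁ init-fin , λ (s , v) → proj₂ init-fin s v)

  -- a firing adds only the tokens produced by the output arcs
  fires-finitelySupported : ∀ {M M′} t β → FinitelySupported M → Fires S N M t β M′ →
                            FinitelySupported M′
  fires-finitelySupported {M} {M′} t β ((Lg , Lg-covers) , (Lt , Lt-covers))
    (π , c , _ , _ , _ , gen≡ , ins , outs , _ , _ , _ , tok≡ , _) =
    (Lg ++ genOut , gen-covers) , (Lt ++ tokOut , tok-covers)
    where
    open Transition (transition t)

    created : Fin k → List (Pid × ℕ)
    created i = (π i , c i + n i) ∷ map (λ j → π i ++ [ (c i + suc j) ⁺ ] , 0) (upTo (n i))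

    genOut : List (Pid × ℕ)
    genOut = concat (tabulate created)

    tokOut : List Token
    tokOut = concat (tabulate (λ s → map (s ,_) (outs s)))

    created-covers : ∀ x i →
      0 < (if toℕ i <ᵇ m then 𝟙[ _≟G_ S N (π i , c i + n i) x ] else 0)
          + sum1to (n i) (λ j → 𝟙[ _≟G_ S N (π i ++ [ (c i + j) ⁺ ] , 0) x ]) →
      x ∈ created i
    created-covers x i p with +-positive (if toℕ i <ᵇ m then _ else 0) p
    ... | inj₁ q = here (sym (𝟙-positive (_≟G_ S N _ x) (if-positive (toℕ i <ᵇ m) q)))
    ... | inj₂ q with sum1to-positive (n i) _ q
    ...   | j , j<n , r rewrite sym (𝟙-positive (_≟G_ S N _ x) r) =
            there (∈-map⁺ (λ j → π i ++ [ (c i + suc j) ⁺ ] , 0) (∈-upTo⁺ j<n))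

    gen-covers : Covers (gen M′) (Lg ++ genOut)
    gen-covers x p
      with ∸+-positive (gen M x) (sumFin k (λ i → 𝟙[ _≟G_ S N (π i , c i) x ]))
                       (subst (0 <_) (gen≡ x) p)
    ... | inj₁ q = ∈-++⁺ˡ (Lg-covers x q)
    ... | inj₂ q with sumFin-positive k _ q
    ...   | i , r = ∈-++⁺ʳ Lg (∈-concat⁺′ (created-covers x i r) (∈-tabulate⁺ i))

    tok-covers : Covers (uncurry (tok M′)) (Lt ++ tokOut)
    tok-covers (s , v) p
      with ∸+-positive (tok M s v) (count (decT S (ℓ s)) (ins s) v) (subst (0 <_) (tok≡ s v) p)
    ... | inj₁ q = ∈-++⁺ˡ (Lt-covers (s , v) q)
    ... | inj₂ q = ∈-++⁺ʳ Lt (∈-concat⁺′ (∈-map⁺ (s ,_) (count-covers (decT S (ℓ s)) (outs s) v q))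
                                        (∈-tabulate⁺ s))

  reachable-finitelySupported : ∀ {M} → Reachable S N M → FinitelySupported M
  reachable-finitelySupported base = M₀-finitelySupported
  reachable-finitelySupported (step t β r f) =
    fires-finitelySupported t β (reachable-finitelySupported r) f

-- Navigation and paths in the pid-trees of a t-net
module PidTrees (S : Setting) (N : TNet S) where

  Tree : Set
  Tree = PTree S N

  Mk : Set
  Mk = Mark S N

  Child : Set
  Child = Pid × Tree

  IsTree : Tree → Set
  IsTree = IsPidTree S N

  Subtree : Pid → Tree → Tree → Set
  Subtree = Sub S N

  _∈pids_ : Pid → Tree → Set
  _∈pids_ = _∈pid_ S N

  _⊆_ : Tree → Tree → Set
  _⊆_ = _⊆T_ S N

  _≤ₘ_ : Mk → Mk → Set
  _≤ₘ_ = _≤M_ S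

  ∅≤ₘ : ∀ {M} → ∅M S ≤ₘ M
  ∅≤ₘ = (λ _ → z≤n) , (λ _ _ → z≤n)

  child-unique : ∀ {cs : List Child} {a b t₁ t₂} → AllPairs (Independent S N) (map proj₁ cs) →
                 (a , t₁) ∈ cs → (b , t₂) ∈ cs → a ∈sub b ⊎ b ∈sub a → a ≡ b × t₁ ≡ t₂
  child-unique _ (here refl) (here refl) _ = refl , refl
  child-unique (a-indep ∷ _) (here refl) (there b∈) rel
    with All.lookup a-indep (∈-map⁺ proj₁ b∈) | rel
  ... | _ , a∉b , _ | inj₁ a∈b = ⊥-elim (a∉b a∈b)
  ... | _ , _ , b∉a | inj₂ b∈a = ⊥-elim (b∉a b∈a)
  child-unique (b-indep ∷ _) (there a∈) (here refl) rel
    with All.lookup b-indep (∈-map⁺ proj₁ a∈) | rel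
  ... | _ , _ , a∉b | inj₁ a∈b = ⊥-elim (a∉b a∈b)
  ... | _ , b∉a , _ | inj₂ b∈a = ⊥-elim (b∉a b∈a)
  child-unique (_ ∷ indep) (there a∈) (there b∈) rel = child-unique indep a∈ b∈ rel

  child-determined : ∀ {M cs a b t₁ t₂ x y} → IsTree (node M cs) →
                     (a , t₁) ∈ cs → (b , t₂) ∈ cs → a ++ x ≡ b ++ y →
                     a ≡ b × t₁ ≡ t₂ × x ≡ y
  child-determined {a = a} {b} (node nonempty indep _) a∈ b∈ e
    with child-unique indep a∈ b∈
           (++-comparable-∈sub a b (All.lookup nonempty a∈) (All.lookup nonempty b∈) e)
  ... | refl , refl = refl , refl , ++-cancelˡ a _ _ e

  child-subtree : ∀ {M cs a t} → (a , t) ∈ cs → Subtree a (node M cs) t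
  child-subtree {a = a} a∈ = subst (λ π → Subtree π _ _) (++-identityʳ a) (there a∈ here)

  subtree-below-child : ∀ {M cs a t ρ t′} → IsTree (node M cs) → (a , t) ∈ cs →
                        Subtree (a ++ ρ) (node M cs) t′ → Subtree ρ t t′
  subtree-below-child T a∈ s = go T a∈ s refl
    where
    go : ∀ {M cs a t ρ π t′} → IsTree (node M cs) → (a , t) ∈ cs →
         Subtree π (node M cs) t′ → π ≡ a ++ ρ → Subtree ρ t t′
    go {a = a} (node nonempty _ _) a∈ here e = ⊥-elim (All.lookup nonempty a∈ (++-emptyˡ a (sym e)))
    go T a∈ (there b∈ s) e with child-determined T b∈ a∈ e
    ... | refl , refl , refl = s

  subtree-via-child : ∀ {M cs π t} → Subtree π (node M cs) t → π ≢ [] →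
                      ∃ λ b → ∃ λ tb → ∃ λ r → (b , tb) ∈ cs × π ≡ b ++ r
  subtree-via-child here π≢[] = ⊥-elim (π≢[] refl)
  subtree-via-child (there b∈ _) _ = _ , _ , _ , b∈ , refl

  subtree-unique : ∀ {T π t₁ t₂} → IsTree T → Subtree π T t₁ → Subtree π T t₂ → t₁ ≡ t₂
  subtree-unique T s₁ s₂ = go T s₁ s₂ refl
    where
    go : ∀ {T π π′ t₁ t₂} → IsTree T → Subtree π T t₁ → Subtree π′ T t₂ → π ≡ π′ → t₁ ≡ t₂
    go _ here here _ = refl
    go (node nonempty _ _) here (there b∈ _) e =
      ⊥-elim (All.lookup nonempty b∈ (++-emptyˡ _ (sym e)))
    go (node nonempty _ _) (there a∈ _) here e = ⊥-elim (All.lookup nonempty a∈ (++-emptyˡ _ e))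
    go T@(node _ _ subtrees) (there a∈ s₁) (there b∈ s₂) e with child-determined T a∈ b∈ e
    ... | refl , refl , refl = go (All.lookup subtrees a∈) s₁ s₂ refl

  ⊆-subtree : ∀ {A B π tA} → A ⊆ B → Subtree π A tA → ∃ λ tB → Subtree π B tB × tA ⊆ tB
  ⊆-subtree A⊆B here = _ , here , A⊆B
  ⊆-subtree (node _ children⊆) (there a∈ s) with find (All.lookup children⊆ a∈)
  ... | _ , b∈ , refl , ta⊆tb with ⊆-subtree ta⊆tb s
  ...   | tB , s′ , tA⊆tB = tB , there b∈ s′ , tA⊆tB

  -- Paths: R contains path(π, M′) iff R has a node at π whose marking is above M′

  contains-path⇒node : ∀ {R π M′} → ContainsPath S N R π M′ →
                       ∃ λ M → ∃ λ cs → Subtree π R (node M cs) × M′ ≤ₘ M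
  contains-path⇒node (_ , (_ , end , _ , _) , path⊆R) with ⊆-subtree path⊆R end
  ... | node M cs , s , node M′≤M _ = M , cs , s , M′≤M

  contains-path⇒pid : ∀ {R π M′} → ContainsPath S N R π M′ → π ∈pids R
  contains-path⇒pid cp with contains-path⇒node cp
  ... | _ , _ , s , _ = _ , s

  pathAlong : ∀ {R π t} → Subtree π R t → Mk → Tree
  pathAlong here M′ = node M′ []
  pathAlong (there {a = a} _ s) M′ = node (∅M S) [ a , pathAlong s M′ ]

  module _ (M′ : Mk) where

    pathAlong-isTree : ∀ {R π t} → IsTree R → (s : Subtree π R t) → IsTree (pathAlong s M′)
    pathAlong-isTree _ here = node [] [] []
    pathAlong-isTree (node nonempty _ subtrees) (there a∈ s) =
      node (All.lookup nonempty a∈ ∷ []) ([] ∷ [])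
           (pathAlong-isTree (All.lookup subtrees a∈) s ∷ [])

    pathAlong-end : ∀ {R π t} → (s : Subtree π R t) → Subtree π (pathAlong s M′) (node M′ [])
    pathAlong-end here = here
    pathAlong-end (there _ s) = there (here refl) (pathAlong-end s)

    pathAlong-pids : ∀ {R π t ρ t′} → IsTree R → (s : Subtree π R t) →
                     Subtree ρ (pathAlong s M′) t′ → ρ ∈sub π ⊎ ρ ≡ []
    pathAlong-pids _ here here = inj₂ refl
    pathAlong-pids _ here (there () _)
    pathAlong-pids _ (there _ _) here = inj₂ refl
    pathAlong-pids (node nonempty _ subtrees) (there {a = a} a∈ s) (there (here refl) s′)
      with pathAlong-pids (All.lookup subtrees a∈) s s′
    ... | inj₁ ρ∈π = inj₁ (∈sub-++ˡ a ρ∈π)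
    ... | inj₂ refl = inj₁ (subst (_∈sub (a ++ _)) (sym (++-identityʳ a))
                                  (∈sub-++ (All.lookup nonempty a∈) _))
    pathAlong-pids _ (there _ _) (there (there ()) _)

    pathAlong-empty : ∀ {R π t ρ M″ cs} → (s : Subtree π R t) →
                      Subtree ρ (pathAlong s M′) (node M″ cs) → ρ ≢ π → IsEmptyM S M″
    pathAlong-empty here here ρ≢π = ⊥-elim (ρ≢π refl)
    pathAlong-empty (there _ _) here _ = (λ _ → refl) , (λ _ _ → refl)
    pathAlong-empty (there {a = a} _ s) (there (here refl) s′) ρ≢π =
      pathAlong-empty s s′ (λ e → ρ≢π (cong (a ++_) e))
    pathAlong-empty here (there () _) _
    pathAlong-empty (there _ _) (there (there ()) _) _

    pathAlong-⊆ : ∀ {R π M cs} → M′ ≤ₘ M → (s : Subtree π R (node M cs)) → pathAlong s M′ ⊆ R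
    pathAlong-⊆ M′≤M here = node M′≤M []
    pathAlong-⊆ M′≤M (there a∈ s) = node ∅≤ₘ (lose a∈ (refl , pathAlong-⊆ M′≤M s) ∷ [])

  node⇒contains-path : ∀ {R π M cs M′} → IsTree R → Subtree π R (node M cs) → M′ ≤ₘ M →
                       ContainsPath S N R π M′
  node⇒contains-path {M′ = M′} R s M′≤M =
    pathAlong s M′ ,
    (pathAlong-isTree M′ R s , pathAlong-end M′ s ,
     (λ _ (_ , s′) → pathAlong-pids M′ R s s′) , (λ _ _ _ s′ → pathAlong-empty M′ s s′)) ,
    pathAlong-⊆ M′ M′≤M s

-- Comparing pid-trees: inclusion from pids and markings, and antisymmetry
module Compare (S : Setting) (N : TNet S) where
  open PidTrees S N

  _⊆pids_ : Tree → Tree → Set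
  A ⊆pids B = ∀ π → π ∈pids A → π ∈pids B

  MarkingsBelow : Tree → Tree → Set
  MarkingsBelow A B = ∀ π {MA csA MB csB} →
    Subtree π A (node MA csA) → Subtree π B (node MB csB) → MA ≤ₘ MB

  _≼_ : Child → Child → Set
  c ≼ c′ = proj₁ c ≡ proj₁ c′ × proj₂ c ⊆ proj₂ c′

  -- children labels are the minimal nonempty pids, so trees with the same
  -- pids have the same children labels
  child-transfer : ∀ {MA csA MB csB a ta} → IsTree (node MA csA) → IsTree (node MB csB) →
                   node MA csA ⊆pids node MB csB → node MB csB ⊆pids node MA csA →
                   (a , ta) ∈ csA → ∃ λ tb → (a , tb) ∈ csB
  child-transfer {csB = csB} {a} {ta} A@(node nonemptyA _ _) (node nonemptyB _ _) A⊆B B⊆A a∈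
    with A⊆B a (ta , child-subtree a∈)
  ... | _ , a-in-B with subtree-via-child a-in-B (All.lookup nonemptyA a∈)
  ... | b , tb , r , b∈ , a≡br with B⊆A b (tb , child-subtree b∈)
  ... | _ , b-in-A with subtree-via-child b-in-A (All.lookup nonemptyB b∈)
  ... | a′ , _ , r′ , a′∈ , b≡a′r′ with child-determined A a∈ a′∈ a≡a′r′r
    where
    open ≡-Reasoning
    a≡a′r′r : a ++ [] ≡ a′ ++ (r′ ++ r)
    a≡a′r′r = begin
      a ++ []          ≡⟨ ++-identityʳ a ⟩
      a                ≡⟨ a≡br ⟩
      b ++ r           ≡⟨ cong (_++ r) b≡a′r′ ⟩
      (a′ ++ r′) ++ r  ≡⟨ ++-assoc a′ r′ r ⟩
      a′ ++ (r′ ++ r)  ∎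
  ... | _ , _ , []≡r′r = tb , subst (λ x → (x , tb) ∈ csB) (sym a≡b) b∈
    where
    a≡b : a ≡ b
    a≡b = trans a≡br (trans (cong (b ++_) (++-emptyʳ r′ (sym []≡r′r))) (++-identityʳ b))

  mutual
    ⊆-from-pids : ∀ {A B} → IsTree A → IsTree B → A ⊆pids B → B ⊆pids A →
                  MarkingsBelow A B → A ⊆ B
    ⊆-from-pids {node _ _} {node _ _} A@(node _ _ subtreesA) B A⊆B B⊆A below =
      node (below [] here here) (children-⊆ A B A⊆B B⊆A below (λ c∈ → c∈) subtreesA)

    -- the children of A (any sublist of them) are matched in B
    children-⊆ : ∀ {MA csA MB csB} → IsTree (node MA csA) → IsTree (node MB csB) →
                 node MA csA ⊆pids node MB csB → node MB csB ⊆pids node MA csA →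
                 MarkingsBelow (node MA csA) (node MB csB) →
                 ∀ {cs} → (∀ {c} → c ∈ cs → c ∈ csA) → All (IsTree ∘ proj₂) cs →
                 All (λ c → Any (c ≼_) csB) cs
    children-⊆ _ _ _ _ _ _ [] = []
    children-⊆ A B@(node _ _ subtreesB) A⊆B B⊆A below {(a , ta) ∷ _} ⊆csA (ta-tree ∷ trees) =
      matched ∷ children-⊆ A B A⊆B B⊆A below (⊆csA ∘ there) trees
      where
      a∈ = ⊆csA (here refl)
      matched : Any ((a , ta) ≼_) _
      matched with child-transfer A B A⊆B B⊆A a∈
      ... | tb , b∈ =
        lose b∈ (refl , ⊆-from-pids ta-tree (All.lookup subtreesB b∈) ta⊆tb tb⊆ta below′)
        where
        ta⊆tb : ta ⊆pids tb
        ta⊆tb ρ (_ , s) with A⊆B (a ++ ρ) (_ , there a∈ s)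
        ... | _ , s′ = _ , subtree-below-child B b∈ s′
        tb⊆ta : tb ⊆pids ta
        tb⊆ta ρ (_ , s) with B⊆A (a ++ ρ) (_ , there b∈ s)
        ... | _ , s′ = _ , subtree-below-child A a∈ s′
        below′ : MarkingsBelow ta tb
        below′ π s₁ s₂ = below (a ++ π) (there a∈ s₁) (there b∈ s₂)

  ≤ₘ-antisym : ∀ {M M′} → M ≤ₘ M′ → M′ ≤ₘ M → _≈M_ S M M′
  ≤ₘ-antisym (gen≤ , tok≤) (gen≥ , tok≥) =
    (λ x → ℕₚ.≤-antisym (gen≤ x) (gen≥ x)) , (λ s v → ℕₚ.≤-antisym (tok≤ s v) (tok≥ s v))

  strictly-sorted : ∀ {cs : List Child} → AllPairs (Independent S N) (map proj₁ cs) →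
                    Linked _≤H_ (map proj₁ cs) → AllPairs _<H_ (map proj₁ cs)
  strictly-sorted indep sorted =
    AllPairs.zipWith (λ (a≤b , a≢b , _) → a≤b , a≢b)
                     (Linkedₚ.Linked⇒AllPairs ≤H-trans sorted , indep)

  match-bound : ∀ {x a t} {ys : List Child} → All ((a <H_) ∘ proj₁) ys →
                Any (x ≼_) ((a , t) ∷ ys) → proj₁ x ≡ a ⊎ a <H proj₁ x
  match-bound _ (here (x≡a , _)) = inj₁ x≡a
  match-bound above (there x≼) with find x≼
  ... | _ , z∈ , x≡z , _ = inj₂ (subst (_ <H_) (sym x≡z) (All.lookup above z∈))

  match-head : ∀ {x a t} {ys : List Child} → All ((a <H_) ∘ proj₁) ys → proj₁ x ≡ a →
               Any (x ≼_) ((a , t) ∷ ys) → proj₂ x ⊆ t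
  match-head _ _ (here (_ , x⊆t)) = x⊆t
  match-head above x≡a (there x≼) with find x≼
  ... | _ , z∈ , x≡z , _ = ⊥-elim (proj₂ (All.lookup above z∈) (trans (sym x≡a) x≡z))

  skip-head : ∀ {a t} {xs ys : List Child} → All ((a <H_) ∘ proj₁) xs →
              All (λ x → Any (x ≼_) ((a , t) ∷ ys)) xs → All (λ x → Any (x ≼_) ys) xs
  skip-head [] [] = []
  skip-head ((_ , a≢x) ∷ above) (here (x≡a , _) ∷ matches) = ⊥-elim (a≢x (sym x≡a))
  skip-head (_ ∷ above) (there x≼ ∷ matches) = x≼ ∷ skip-head above matches

  heads-agree : ∀ {a b} → a ≡ b ⊎ b <H a → b ≡ a ⊎ a <H b → a ≡ b
  heads-agree (inj₁ a≡b) _ = a≡b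
  heads-agree (inj₂ _) (inj₁ b≡a) = sym b≡a
  heads-agree (inj₂ (b≤a , _)) (inj₂ (a≤b , _)) = ≤H-antisym a≤b b≤a

  mutual
    ⊆-antisym : ∀ {A B} → IsTree A → IsTree B → SiblingOrdered S N A → SiblingOrdered S N B →
                A ⊆ B → B ⊆ A → _≋_ S N A B
    ⊆-antisym (node _ indepA treesA) (node _ indepB treesB)
              (node sortedA orderedA) (node sortedB orderedB)
              (node MA≤MB A→B) (node MB≤MA B→A) =
      node (≤ₘ-antisym MA≤MB MB≤MA)
           (children-≋ (strictly-sorted indepA sortedA) (strictly-sorted indepB sortedB)
                       treesA treesB orderedA orderedB A→B B→A)

    children-≋ : ∀ {xs ys : List Child} →
                 AllPairs _<H_ (map proj₁ xs) → AllPairs _<H_ (map proj₁ ys) →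
                 All (IsTree ∘ proj₂) xs → All (IsTree ∘ proj₂) ys →
                 All (SiblingOrdered S N ∘ proj₂) xs → All (SiblingOrdered S N ∘ proj₂) ys →
                 All (λ x → Any (x ≼_) ys) xs → All (λ y → Any (y ≼_) xs) ys →
                 Pointwise (λ x y → proj₁ x ≡ proj₁ y × _≋_ S N (proj₂ x) (proj₂ y)) xs ys
    children-≋ {[]} {[]} _ _ _ _ _ _ _ _ = []
    children-≋ {[]} {_ ∷ _} _ _ _ _ _ _ _ (() ∷ _)
    children-≋ {_ ∷ _} {[]} _ _ _ _ _ _ (() ∷ _) _
    children-≋ {(a , ta) ∷ xs} {(b , tb) ∷ ys} (a< ∷ xs<) (b< ∷ ys<) (ta-tree ∷ xs-trees)
               (tb-tree ∷ ys-trees) (ta-ord ∷ xs-ord) (tb-ord ∷ ys-ord) (a≼ ∷ xs≼) (b≼ ∷ ys≼)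
      with heads-agree (match-bound (Allₚ.map⁻ b<) a≼) (match-bound (Allₚ.map⁻ a<) b≼)
    ... | refl =
      (refl , ⊆-antisym ta-tree tb-tree ta-ord tb-ord (match-head (Allₚ.map⁻ b<) refl a≼)
                                                      (match-head (Allₚ.map⁻ a<) refl b≼)) ∷
      children-≋ xs< ys< xs-trees ys-trees xs-ord ys-ord
                 (skip-head (Allₚ.map⁻ a<) xs≼) (skip-head (Allₚ.map⁻ b<) ys≼)

-- The pid-tree with pid set {⟨⟩} ∪ P and node markings D, for a duplicate-free
-- list P of nonempty pids sorted hierarchically: the children of the node σ are
-- the elements of P immediately below σ.
module Build (S : Setting) (N : TNet S) (P : List Pid) (D : Pid → Mark S N)
             (P-unique : AllPairs _≢_ P) (P-sorted : Linked _≤H_ P) where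
  open PidTrees S N

  Adjacent : Pid → Pid → Set
  Adjacent σ π = σ ⊏ π × ¬ Any (λ ρ → σ ⊏ ρ × ρ ⊏ π) P

  adjacent? : ∀ σ π → Dec (Adjacent σ π)
  adjacent? σ π = (σ ⊏? π) ×-dec ¬? (any? (λ ρ → (σ ⊏? ρ) ×-dec (ρ ⊏? π)) P)

  successors : Pid → List Pid
  successors σ = filter (adjacent? σ) P

  IsSuccessor : Pid → Pid → Set
  IsSuccessor σ π = π ∈ P × Adjacent σ π

  successor⁻ : ∀ {σ π} → π ∈ successors σ → IsSuccessor σ π
  successor⁻ = ∈-filter⁻ (adjacent? _)

  no-successor-between : ∀ {σ u v} → IsSuccessor σ v → u ∈ P → σ ⊏ u → ¬ (u ⊏ v)
  no-successor-between (_ , _ , nothing-between) u∈P σ⊏u u⊏v =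
    nothing-between (lose u∈P (σ⊏u , u⊏v))

  tree : ℕ → Pid → Tree
  tree zero σ = node (D σ) []
  tree (suc f) σ = node (D σ) (map (λ π → suffix σ π , tree f π) (successors σ))

  successors-independent : ∀ {σ x y} → IsSuccessor σ x → IsSuccessor σ y → x ≢ y →
                           Independent S N (suffix σ x) (suffix σ y)
  successors-independent {σ} x-succ y-succ x≢y =
    (λ e → x≢y (trans (⊏-split (σ⊏ x-succ)) (trans (cong (σ ++_) e) (sym (⊏-split (σ⊏ y-succ)))))) ,
    not-below x-succ y-succ x≢y , not-below y-succ x-succ (x≢y ∘ sym)
    where
    σ⊏ : ∀ {π} → IsSuccessor σ π → σ ⊏ π
    σ⊏ (_ , σ⊏π , _) = σ⊏π
    not-below : ∀ {u v} → IsSuccessor σ u → IsSuccessor σ v → u ≢ v →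
                ¬ (suffix σ u ∈sub suffix σ v)
    not-below u-succ v-succ u≢v u∈v
      with ⊑⇒≡⊎⊏ (suffix-⊑ (σ⊏ u-succ) (σ⊏ v-succ) (∈sub⇒⊑ u∈v))
    ... | inj₁ u≡v = u≢v u≡v
    ... | inj₂ u⊏v = no-successor-between v-succ (proj₁ u-succ) (σ⊏ u-succ) u⊏v

  successors-good : ∀ σ → All (IsSuccessor σ) (successors σ)
  successors-good σ = All.tabulate successor⁻

  tree-isTree : ∀ f σ → IsTree (tree f σ)
  tree-isTree zero σ = node [] [] []
  tree-isTree (suc f) σ = node
    (Allₚ.map⁺ (All.map (λ (_ , σ⊏π , _) → suffix-nonempty σ⊏π) (successors-good σ)))
    (subst (AllPairs (Independent S N)) (map-∘ (successors σ))
      (AllPairsₚ.map⁺ (AllPairs-restrict successors-independent (successors-good σ)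
                                        (AllPairsₚ.filter⁺ (adjacent? σ) P-unique))))
    (Allₚ.map⁺ (All.tabulate (λ {π} _ → tree-isTree f π)))

  tree-ordered : ∀ f σ → SiblingOrdered S N (tree f σ)
  tree-ordered zero σ = node [] []
  tree-ordered (suc f) σ = node
    (subst (Linked _≤H_) (map-∘ (successors σ))
      (Linkedₚ.map⁺ (Linked-restrict (λ (_ , σ⊏x , _) (_ , σ⊏y , _) → suffix-≤H σ⊏x σ⊏y)
                                    (successors-good σ)
                                    (Linkedₚ.filter⁺ (adjacent? σ) ≤H-trans P-sorted))))
    (Allₚ.map⁺ (All.tabulate (λ {π} _ → tree-ordered f π)))

  marking : Tree → Mk
  marking (node M _) = M

  tree-subtree : ∀ f σ {ρ t} → Subtree ρ (tree f σ) t →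
                 (ρ ≡ [] ⊎ σ ++ ρ ∈ P) × marking t ≡ D (σ ++ ρ)
  tree-subtree zero σ here = inj₁ refl , cong D (sym (++-identityʳ σ))
  tree-subtree (suc f) σ here = inj₁ refl , cong D (sym (++-identityʳ σ))
  tree-subtree (suc f) σ (there {π = ρ} c∈ s) with ∈-map⁻ (λ π → suffix σ π , tree f π) c∈
  ... | π , π∈ , refl with successor⁻ π∈ | tree-subtree f π s
  ...   | π∈P , σ⊏π , _ | ρ-pid , ρ-marking = inj₂ (in-P ρ-pid) , trans ρ-marking (cong D π++ρ)
    where
    π++ρ : π ++ ρ ≡ σ ++ (suffix σ π ++ ρ)
    π++ρ = trans (cong (_++ ρ) (⊏-split σ⊏π)) (++-assoc σ _ ρ)
    in-P : ρ ≡ [] ⊎ π ++ ρ ∈ P → σ ++ (suffix σ π ++ ρ) ∈ P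
    in-P (inj₁ refl) = subst (_∈ P) (trans (sym (++-identityʳ π)) π++ρ) π∈P
    in-P (inj₂ πρ∈P) = subst (_∈ P) π++ρ πρ∈P

  nearest-successor : ∀ n σ π → length π < n → π ∈ P → σ ⊏ π →
                      ∃ λ c → IsSuccessor σ c × (c ≡ π ⊎ c ⊏ π)
  nearest-successor (suc n) σ π (s≤s π<n) π∈P σ⊏π
    with any? (λ ρ → (σ ⊏? ρ) ×-dec (ρ ⊏? π)) P
  ... | no nothing-between = π , (π∈P , σ⊏π , nothing-between) , inj₁ refl
  ... | yes between with find between
  ...   | ρ , ρ∈P , σ⊏ρ , ρ⊏π
          with nearest-successor n σ ρ (ℕₚ.<-≤-trans (⊏-length ρ⊏π) π<n) ρ∈P σ⊏ρ
  ...     | c , c-succ , inj₁ refl = c , c-succ , inj₂ ρ⊏π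
  ...     | c , c-succ , inj₂ c⊏ρ = c , c-succ , inj₂ (⊏-trans c⊏ρ ρ⊏π)

  DeepEnough : ℕ → Pid → Set
  DeepEnough f σ = ∀ ρ → ρ ∈ P → σ ⊏ ρ → length ρ < length σ + f

  successor-child : ∀ f {σ c} → IsSuccessor σ c →
                    (suffix σ c , tree f c) ∈ map (λ π → suffix σ π , tree f π) (successors σ)
  successor-child f {σ} (c∈P , adjacent) =
    ∈-map⁺ (λ π → suffix σ π , tree f π) (∈-filter⁺ (adjacent? σ) c∈P adjacent)

  tree-complete : ∀ f σ {π} → π ∈ P → (σ⊏π : σ ⊏ π) → DeepEnough f σ →
                  ∃ λ t → Subtree (proj₁ σ⊏π) (tree f σ) t
  tree-complete zero σ π∈P σ⊏π deep =
    ⊥-elim (ℕₚ.<-asym (⊏-length σ⊏π) (subst (_ <_) (ℕₚ.+-identityʳ _) (deep _ π∈P σ⊏π)))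
  tree-complete (suc f) σ {π} π∈P σ⊏π@(r , _ , refl) deep
    with nearest-successor (suc (length π)) σ π ℕₚ.≤-refl π∈P σ⊏π
  ... | c , c-succ , inj₁ refl =
    tree f π , subst (λ x → Subtree x (tree (suc f) σ) (tree f π)) label
                     (there (successor-child f c-succ) here)
    where
    label : suffix σ π ++ [] ≡ r
    label = trans (++-identityʳ _) (suffix-++ σ r)
  ... | c , c-succ@(_ , σ⊏c , _) , inj₂ c⊏π@(r′ , _ , π≡cr′)
    with tree-complete f c π∈P c⊏π deep′
    where
    deep′ : DeepEnough f c
    deep′ ρ ρ∈P c⊏ρ = ℕₚ.<-≤-trans (deep ρ ρ∈P (⊏-trans σ⊏c c⊏ρ))
      (subst (_≤ length c + f) (sym (ℕₚ.+-suc (length σ) f)) (ℕₚ.+-monoˡ-≤ f (⊏-length σ⊏c)))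
  ...   | t , s = t , subst (λ x → Subtree x (tree (suc f) σ) t) label
                          (there (successor-child f c-succ) s)
    where
    label : suffix σ c ++ r′ ≡ r
    label = ++-cancelˡ σ _ _ (begin
      σ ++ (suffix σ c ++ r′)   ≡⟨ ++-assoc σ _ r′ ⟨
      (σ ++ suffix σ c) ++ r′   ≡⟨ cong (_++ r′) (⊏-split σ⊏c) ⟨
      c ++ r′                   ≡⟨ π≡cr′ ⟨
      σ ++ r                    ∎)
      where open ≡-Reasoning

decoratedPid-cases : ∀ S N ty (v : Tok S ty) →
                     decoratedPid S N ty v ≡ [] ⊎ decoratedPid S N ty v ∈ pidsOf S ty v
decoratedPid-cases S N (𝐏 , _) _ = inj₂ (here refl)
decoratedPid-cases S N (𝐃 , _) _ = inj₁ refl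

single-self : ∀ {S : Setting} {nS ℓ} (s : Fin nS) (v : Tok S (ℓ s)) k →
              singleCount S {nS} {ℓ} s v k s v ≡ k
single-self {S} {ℓ = ℓ} s v k with s Finₚ.≟ s
... | yes refl = if-self (decT S (ℓ s) v v) refl
... | no s≢s = ⊥-elim (s≢s refl)

-- The canonical representation of a finitely supported marking M

module Canonical (S : Setting) (N : TNet S) (M : Mark S N)
                 (supported : Support.FinitelySupported S N M) where
  open PidTrees S N
  open Compare S N
  open TNet N using (nS; ℓ)
  open Support S N using (Token)

  -- the pids other than ⟨⟩ forced into a representation: active and next pids
  Required : Pid → Set
  Required π = ActivePid S N M π ⊎ NextPid S N M π

  owner : (s : Fin nS) → Tok S (ℓ s) → Pid
  owner s v = decoratedPid S N (ℓ s) v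

  genSupport : List (Pid × ℕ)
  genSupport = filter (λ x → 0 ℕₚ.<? gen M x) (proj₁ (proj₁ supported))

  tokSupport : List Token
  tokSupport = filter (λ sv → 0 ℕₚ.<? uncurry (tok M) sv) (proj₁ (proj₂ supported))

  genSupport⁻ : ∀ {x} → x ∈ genSupport → 0 < gen M x
  genSupport⁻ x∈ = proj₂ (∈-filter⁻ (λ x → 0 ℕₚ.<? gen M x) {xs = proj₁ (proj₁ supported)} x∈)

  genSupport⁺ : ∀ {x} → 0 < gen M x → x ∈ genSupport
  genSupport⁺ p = ∈-filter⁺ (λ x → 0 ℕₚ.<? gen M x) (proj₂ (proj₁ supported) _ p) p

  tokSupport⁻ : ∀ {sv} → sv ∈ tokSupport → 0 < uncurry (tok M) sv
  tokSupport⁻ sv∈ =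
    proj₂ (∈-filter⁻ (λ sv → 0 ℕₚ.<? uncurry (tok M) sv) {xs = proj₁ (proj₂ supported)} sv∈)

  tokSupport⁺ : ∀ {sv} → 0 < uncurry (tok M) sv → sv ∈ tokSupport
  tokSupport⁺ p = ∈-filter⁺ (λ sv → 0 ℕₚ.<? uncurry (tok M) sv) (proj₂ (proj₂ supported) _ p) p

  genPids : Pid × ℕ → List Pid
  genPids (π , i) = π ∷ (π ++ [ pos i ]) ∷ []

  tokPids : Token → List Pid
  tokPids (s , v) = pidsOf S (ℓ s) v

  candidates : List Pid
  candidates = concatMap genPids genSupport ++ concatMap tokPids tokSupport

  candidate-required : ∀ {π} → π ∈ candidates → Required π
  candidate-required π∈ with ∈-++⁻ (concatMap genPids genSupport) π∈
  ... | inj₁ π∈gen with find (∈-concatMap⁻ genPids {xs = genSupport} π∈gen)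
  ...   | (ρ , i) , x∈ , here refl = inj₁ (inj₁ (i , genSupport⁻ x∈))
  ...   | (ρ , i) , x∈ , there (here refl) = inj₂ (ρ , i , genSupport⁻ x∈ , refl)
  candidate-required π∈ | inj₂ π∈tok with find (∈-concatMap⁻ tokPids {xs = tokSupport} π∈tok)
  ...   | (s , v) , sv∈ , π∈v = inj₁ (inj₂ (s , v , tokSupport⁻ sv∈ , π∈v))

  required-candidate : ∀ {π} → Required π → π ∈ candidates
  required-candidate (inj₁ (inj₁ (i , p))) =
    ∈-++⁺ˡ (∈-concatMap⁺ genPids (lose (genSupport⁺ p) (here refl)))
  required-candidate (inj₂ (ρ , i , p , refl)) =
    ∈-++⁺ˡ (∈-concatMap⁺ genPids (lose (genSupport⁺ p) (there (here refl))))
  required-candidate (inj₁ (inj₂ (s , v , p , π∈v))) =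
    ∈-++⁺ʳ _ (∈-concatMap⁺ tokPids (lose (tokSupport⁺ {s , v} p) π∈v))

  pids : List Pid
  pids = normalise (filter (λ π → ¬? (π ≟P [])) candidates)

  pids⁻ : ∀ {π} → π ∈ pids → π ≢ [] × Required π
  pids⁻ π∈ with ∈-filter⁻ (λ π → ¬? (π ≟P [])) (normalise⁻ _ π∈)
  ... | π∈cand , π≢[] = π≢[] , candidate-required π∈cand

  pids⁺ : ∀ {π} → π ≢ [] → Required π → π ∈ pids
  pids⁺ π≢[] req = normalise⁺ (∈-filter⁺ (λ π → ¬? (π ≟P [])) (required-candidate req) π≢[])

  decoration : Pid → Mark S N
  decoration π = mk (λ _ → 0) (λ s v → if does (owner s v ≟P π) then tok M s v else 0)

  open Build S N pids decoration (normalise-unique _) (normalise-sorted _)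

  -- the canonical tree, deep enough to contain every pid of the list
  depth : ℕ
  depth = suc (maxLength pids)

  R : Tree
  R = tree depth []

  R-isTree : IsTree R
  R-isTree = tree-isTree depth []

  R-ordered : SiblingOrdered S N R
  R-ordered = tree-ordered depth []

  R-pids⁻ : ∀ {π} → π ∈pids R → π ≡ [] ⊎ π ∈ pids
  R-pids⁻ (_ , s) = proj₁ (tree-subtree depth [] s)

  R-marking : ∀ {π MR cs} → Subtree π R (node MR cs) → MR ≡ decoration π
  R-marking s = proj₂ (tree-subtree depth [] s)

  R-pids⁺ : ∀ {π} → Required π → π ∈pids R
  R-pids⁺ {π} req with π ≟P []
  ... | yes refl = R , here
  ... | no π≢[] = tree-complete depth [] (pids⁺ π≢[] req) (π , π≢[] , refl)
                    (λ ρ ρ∈ _ → s≤s (maxLength-≥ ρ∈))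

  owner-in-R : ∀ s v → 0 < tok M s v → owner s v ∈pids R
  owner-in-R s v p with decoratedPid-cases S N (ℓ s) v
  ... | inj₁ owner≡[] = subst (_∈pids R) (sym owner≡[]) (R , here)
  ... | inj₂ owner∈v = R-pids⁺ (inj₁ (inj₂ (s , v , p , owner∈v)))

  R-contains : ∀ {π M′} → π ∈pids R → M′ ≤ₘ decoration π → ContainsPath S N R π M′
  R-contains {M′ = M′} (node _ _ , s) M′≤ =
    node⇒contains-path R-isTree s (subst (M′ ≤ₘ_) (sym (R-marking s)) M′≤)

  single≤decoration : ∀ s v → single S s v (tok M s v) ≤ₘ decoration (owner s v)
  single≤decoration s v = (λ _ → z≤n) , below
    where
    below : ∀ s′ v′ → singleCount S s v (tok M s v) s′ v′ ≤ tok (decoration (owner s v)) s′ v′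
    below s′ v′ with s Finₚ.≟ s′
    ... | no _ = z≤n
    ... | yes refl = same-place (decT S (ℓ s) v v′)
      where
      same-place : (d : Dec (v ≡ v′)) →
                   (if does d then tok M s v else 0) ≤ tok (decoration (owner s v)) s v′
      same-place (yes refl) = ℕₚ.≤-reflexive (sym (if-self (owner s v ≟P owner s v) refl))
      same-place (no _) = z≤n

  R-rules : RulesHold S N M R
  R-rules =
    (λ π i p → R-contains (R-pids⁺ (inj₁ (inj₁ (i , p)))) ∅≤ₘ ,
               R-contains (R-pids⁺ (inj₂ (π , i , p , refl))) ∅≤ₘ) ,
    (λ s v p → R-contains (owner-in-R s v p) (single≤decoration s v) ,
               All.tabulate (λ π∈v → R-contains (R-pids⁺ (inj₁ (inj₂ (s , v , p , π∈v)))) ∅≤ₘ))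

  rules-pids : ∀ {R′} → RulesHold S N M R′ → ∀ {π} → Required π → π ∈pids R′
  rules-pids (gen-rule , _) (inj₁ (inj₁ (i , p))) = contains-path⇒pid (proj₁ (gen-rule _ i p))
  rules-pids (gen-rule , _) (inj₂ (ρ , i , p , refl)) = contains-path⇒pid (proj₂ (gen-rule ρ i p))
  rules-pids (_ , tok-rule) (inj₁ (inj₂ (s , v , p , π∈v))) =
    contains-path⇒pid (All.lookup (proj₂ (tok-rule s v p)) π∈v)

  rules-markings : ∀ {R′ π MB cs} → IsTree R′ → RulesHold S N M R′ →
                   Subtree π R′ (node MB cs) → decoration π ≤ₘ MB
  rules-markings {R′} {π} {MB} R′-tree (_ , tok-rule) s = (λ _ → z≤n) , below
    where
    owned-tokens : ∀ s′ v′ → owner s′ v′ ≡ π → 0 < tok M s′ v′ → tok M s′ v′ ≤ tok MB s′ v′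
    owned-tokens s′ v′ refl p with contains-path⇒node (proj₁ (tok-rule s′ v′ p))
    ... | _ , _ , s″ , single≤ with subtree-unique R′-tree s″ s
    ...   | refl = subst (_≤ tok MB s′ v′) (single-self s′ v′ (tok M s′ v′)) (proj₂ single≤ s′ v′)
    below : ∀ s′ v′ → tok (decoration π) s′ v′ ≤ tok MB s′ v′
    below s′ v′ = if-≤ (owner s′ v′ ≟P π) (λ owned → ≤-when-positive (owned-tokens s′ v′ owned))

  R-least : ∀ {R′} → IsTree R′ → RulesHold S N M R′ → R′ ⊆pids R → R ⊆ R′
  R-least R′-tree rules R′⊆R = ⊆-from-pids R-isTree R′-tree R⊆R′ R′⊆R below
    where
    R⊆R′ : R ⊆pids _
    R⊆R′ π π∈R with R-pids⁻ π∈R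
    ... | inj₁ refl = _ , here
    ... | inj₂ π∈ = rules-pids rules (proj₂ (pids⁻ π∈))
    below : MarkingsBelow R _
    below π s₁ s₂ = subst (_≤ₘ _) (sym (R-marking s₁)) (rules-markings R′-tree rules s₂)

  R-minimal : ∀ R′ → IsTree R′ → R′ ⊆ R → RulesHold S N M R′ → R ⊆ R′
  R-minimal R′ R′-tree R′⊆R rules = R-least R′-tree rules R′-pids⊆R
    where
    R′-pids⊆R : R′ ⊆pids R
    R′-pids⊆R π (_ , s) with ⊆-subtree R′⊆R s
    ... | tR , s′ , _ = tR , s′

  R-repr : Repr S N M R
  R-repr = R-isTree , R-ordered , R-rules , R-minimal

  R-stripped : Stripped S N M R
  R-stripped π π∈R π≢[] with R-pids⁻ π∈R
  ... | inj₁ π≡[] = ⊥-elim (π≢[] π≡[])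
  ... | inj₂ π∈ = proj₂ (pids⁻ π∈)

  -- a stripped representation has its pids in R, hence coincides with R
  R-unique : ∀ R′ → Repr S N M R′ → Stripped S N M R′ → _≋_ S N R′ R
  R-unique R′ (R′-tree , R′-ordered , rules , minimal) stripped =
    ⊆-antisym R′-tree R-isTree R′-ordered R-ordered R′⊆R R⊆R′
    where
    R′-pids⊆R : R′ ⊆pids R
    R′-pids⊆R π π∈R′ with π ≟P []
    ... | yes refl = R , here
    ... | no π≢[] = R-pids⁺ (stripped π π∈R′ π≢[])
    R⊆R′ : R ⊆ R′
    R⊆R′ = R-least R′-tree rules R′-pids⊆R
    R′⊆R : R′ ⊆ R
    R′⊆R = minimal R R-isTree R⊆R′ R-rules

proposition5 : (S : Setting) (N : TNet S) (M : Mark S N) →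
    Reachable S N M →
    Σ (PTree S N) (λ R →
      (Repr S N M R × Stripped S N M R) ×
      ((R' : PTree S N) → Repr S N M R' → Stripped S N M R' → _≋_ S N R' R))
proposition5 S N M reachable = R , (R-repr , R-stripped) , R-unique
  where open Canonical S N M (Support.reachable-finitelySupported S N reachable)
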